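{- Let $E$ be a finite set and $\mathcal{F}\subseteq 2^E$. Then $(E,\mathcal{F})$ is a convex geometry if and only if the following three conditions hold: (1) $\varnothing\in\mathcal{F}$ and $E\in\mathcal{F}$; (2) $(E,\mathcal{F})$ satisfies the chain property; (3) the extreme point operator $ex$ of $(E,\mathcal{F})$ satisfies the heritage property.
   Context: A set system $(E,\mathcal{F})$ is a convex geometry if: $\varnothing\in\mathcal{F}$, $E\in\mathcal{F}$; $X,Y\in\mathcal{F}$ implies $X\cap Y\in\mathcal{F}$; and for every $X\in\mathcal{F}$ with $X\neq E$ there exists $x\in E-X$ with $X\cup\{x\}\in\mathcal{F}$. The chain property: for all $X,Y\in\mathcal{F}$ with $X\subset Y$ (proper) there exists $y\in Y-X$ with $Y-\{y\}\in\mathcal{F}$. For $X\in\mathcal{F}$, $ex(X)=\{x\in X: X-\{x\}\in\mathcal{F}\}$ is the set of extreme points of $X$. The operator $ex$ satisfies the heritage property if for all $X,Y\in\mathcal{F}$ with $X\subseteq Y$ we have $ex(Y)\cap X\subseteq ex(X)$. -}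

module Defs where

open import Data.Nat using (ℕ)
open import Data.Fin using (Fin)
open import Data.Fin.Subset using (Subset; ⊥; ⊤; _∈_; _∉_; _⊆_; _⊂_; _∩_; _∪_; ⁅_⁆; _-_)
open import Data.Product using (_×_; ∃-syntax)
open import Relation.Binary.PropositionalEquality using (_≡_)
open import Relation.Nullary using (¬_)

-- Ground set E = Fin n (an arbitrary finite set, up to relabelling);
-- a set family F ⊆ 2^E is given as a predicate on subsets of E.
Family : ℕ → Set₁
Family n = Subset n → Set

module _ {n : ℕ} (F : Family n) where

  record IsConvexGeometry : Set where
    field
      empty∈   : F ⊥
      full∈    : F ⊤
      ∩-closed : ∀ X Y → F X → F Y → F (X ∩ Y)
      augment  : ∀ X → F X → ¬ (X ≡ ⊤) → ∃[ x ] (x ∉ X × F (X ∪ ⁅ x ⁆))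

  ChainProperty : Set
  ChainProperty = ∀ X Y → F X → F Y → X ⊂ Y →
                  ∃[ y ] (y ∈ Y × y ∉ X × F (Y - y))

  IsExtreme : Subset n → Fin n → Set
  IsExtreme X x = x ∈ X × F (X - x)

  Heritage : Set
  Heritage = ∀ X Y → F X → F Y → X ⊆ Y →
             ∀ x → IsExtreme Y x → x ∈ X → IsExtreme X x

-- Forward: for feasible X ⊆ Y the feasible set Y - x meets X in X - x, which is
-- heritage; for the chain property, augment X point by point until one more
-- point x would cover Y, and then Y ∩ Z = Y - x for the last set Z.
-- Backward: both closure axioms come from walking down from E by the chain
-- property. Walking down towards X stops at X ∪ {y}, which gives augmentation.
-- Walking down towards Y from a superset of X must at some step remove a point
-- y of X; heritage then makes X - y feasible, and (X - y) ∩ Y = X ∩ Y, so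
-- induction on X shows X ∩ Y feasible.
module Submission where

open import Defs
open import Data.Nat using (ℕ)
open import Data.Fin using (Fin; _≟_)
open import Data.Fin.Subset
  using (Subset; inside; outside; ⊥; ⊤; _∈_; _∉_; _⊆_; _⊈_; _⊂_; _⊃_; _∩_; _∪_; _─_; _-_; ⁅_⁆)
open import Data.Fin.Subset.Properties
open import Data.Fin.Subset.Induction using (⊂-wellFounded; ⊃-wellFounded)
open import Data.Product using (_×_; _,_; proj₁; proj₂; ∃-syntax)
open import Data.Empty using (⊥-elim)
open import Data.Sum using (_⊎_; inj₁; inj₂)
open import Data.Vec using (_∷_; here; there)
open import Function.Bundles using (_⇔_; mk⇔)
open import Induction.WellFounded using (Acc; acc)
open import Relation.Nullary using (Dec; yes; no; contradiction)
open import Relation.Nullary.Decidable using (decidable-stable)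
open import Relation.Binary.PropositionalEquality using (_≡_; _≢_; refl; sym; subst)

private
  variable
    n : ℕ
    p q : Subset n
    x y : Fin n

x∈p─q⇒x∉q : ∀ (p q : Subset n) → x ∈ p ─ q → x ∉ q
x∈p─q⇒x∉q (inside ∷ p) (outside ∷ q) here                  = λ ()
x∈p─q⇒x∉q (_ ∷ p)      (_ ∷ q)       (there x∈) (there x∈q) = x∈p─q⇒x∉q p q x∈ x∈q

x∈p-y⁻ : ∀ (p : Subset n) → x ∈ p - y → x ∈ p × x ≢ y
x∈p-y⁻ {y = y} p x∈ = p─q⊆p p ⁅ y ⁆ x∈ , x∉⁅y⁆⇒x≢y (x∈p─q⇒x∉q p ⁅ y ⁆ x∈)

p⊈q⇒∃x∈p∖q : p ⊈ q → ∃[ x ] (x ∈ p × x ∉ q)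
p⊈q⇒∃x∈p∖q {p = p} {q} p⊈q with nonempty? (p ─ q)
... | yes (x , x∈p─q) = x , p─q⊆p p q x∈p─q , x∈p─q⇒x∉q p q x∈p─q
... | no p─q-empty    = ⊥-elim (p⊈q p⊆q)
  where
  p⊆q : p ⊆ q
  p⊆q {x} x∈p = decidable-stable (x ∈? q) λ x∉q → p─q-empty (x , x∈p∧x∉q⇒x∈p─q x∈p x∉q)

p⊆q∧q⊈p⇒p⊂q : p ⊆ q → q ⊈ p → p ⊂ q
p⊆q∧q⊈p⇒p⊂q p⊆q q⊈p = p⊆q , p⊈q⇒∃x∈p∖q q⊈p

p⊆q∧x∉p⇒p⊆q-x : p ⊆ q → x ∉ p → p ⊆ q - x
p⊆q∧x∉p⇒p⊆q-x p⊆q x∉p y∈p = x∈p∧x≢y⇒x∈p-y (p⊆q y∈p) (λ { refl → x∉p y∈p })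

x∉p⇒p⊂p∪⁅x⁆ : x ∉ p → p ⊂ p ∪ ⁅ x ⁆
x∉p⇒p⊂p∪⁅x⁆ {x = x} {p = p} x∉p = p⊆p∪q ⁅ x ⁆ , x , q⊆p∪q p ⁅ x ⁆ (x∈⁅x⁆ x) , x∉p

x∈q∪⁅y⁆∧x≢y⇒x∈q : x ∈ q ∪ ⁅ y ⁆ → x ≢ y → x ∈ q
x∈q∪⁅y⁆∧x≢y⇒x∈q {q = q} {y = y} x∈ x≢y with x∈p∪q⁻ q ⁅ y ⁆ x∈
... | inj₁ x∈q   = x∈q
... | inj₂ x∈⁅y⁆ = contradiction (x∈⁅y⁆⇒x≡y y x∈⁅y⁆) x≢y

p⊆q⇒p∩[q-x]≡p-x : p ⊆ q → p ∩ (q - x) ≡ p - x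
p⊆q⇒p∩[q-x]≡p-x {p = p} {q} {x} p⊆q = ⊆-antisym
  (λ z∈ → let z∈p , z∈q-x = x∈p∩q⁻ p (q - x) z∈ in x∈p∧x≢y⇒x∈p-y z∈p (proj₂ (x∈p-y⁻ q z∈q-x)))
  (λ z∈ → let z∈p , z≢x = x∈p-y⁻ p z∈ in x∈p∩q⁺ (z∈p , x∈p∧x≢y⇒x∈p-y (p⊆q z∈p) z≢x))

x∉q⇒[p-x]∩q≡p∩q : x ∉ q → (p - x) ∩ q ≡ p ∩ q
x∉q⇒[p-x]∩q≡p∩q {x = x} {q = q} {p = p} x∉q = ⊆-antisym
  (λ z∈ → let z∈p-x , z∈q = x∈p∩q⁻ (p - x) q z∈ in x∈p∩q⁺ (proj₁ (x∈p-y⁻ p z∈p-x) , z∈q))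
  (λ z∈ → let z∈p , z∈q = x∈p∩q⁻ p q z∈ in
    x∈p∩q⁺ (x∈p∧x≢y⇒x∈p-y z∈p (λ { refl → x∉q z∈q }) , z∈q))

p-x⊆q∧x∉q⇒p∩q≡p-x : p - x ⊆ q → x ∉ q → p ∩ q ≡ p - x
p-x⊆q∧x∉q⇒p∩q≡p-x {p = p} {q = q} p-x⊆q x∉q = ⊆-antisym
  (λ z∈ → let z∈p , z∈q = x∈p∩q⁻ p q z∈ in x∈p∧x≢y⇒x∈p-y z∈p (λ { refl → x∉q z∈q }))
  (λ z∈ → x∈p∩q⁺ (proj₁ (x∈p-y⁻ p z∈) , p-x⊆q z∈))

p⊆q∧q-x⊆p⇒q≡p∪⁅x⁆ : p ⊆ q → x ∈ q → q - x ⊆ p → q ≡ p ∪ ⁅ x ⁆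
p⊆q∧q-x⊆p⇒q≡p∪⁅x⁆ {p = p} {q} {x} p⊆q x∈q q-x⊆p = ⊆-antisym q⊆p∪⁅x⁆ p∪⁅x⁆⊆q
  where
  q⊆p∪⁅x⁆ : q ⊆ p ∪ ⁅ x ⁆
  q⊆p∪⁅x⁆ {z} z∈q with z ≟ x
  ... | yes refl = q⊆p∪q p ⁅ x ⁆ (x∈⁅x⁆ x)
  ... | no z≢x   = p⊆p∪q ⁅ x ⁆ (q-x⊆p (x∈p∧x≢y⇒x∈p-y z∈q z≢x))
  p∪⁅x⁆⊆q : p ∪ ⁅ x ⁆ ⊆ q
  p∪⁅x⁆⊆q z∈ with x∈p∪q⁻ p ⁅ x ⁆ z∈
  ... | inj₁ z∈p   = p⊆q z∈p
  ... | inj₂ z∈⁅x⁆ = subst (_∈ q) (sym (x∈⁅y⁆⇒x≡y x z∈⁅x⁆)) x∈q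

module _ {n : ℕ} (F : Family n) where

  IntersectionClosed : Set
  IntersectionClosed = ∀ X Y → F X → F Y → F (X ∩ Y)

  Augmentable : Set
  Augmentable = ∀ X → F X → X ≢ ⊤ → ∃[ x ] (x ∉ X × F (X ∪ ⁅ x ⁆))

  ∩-closed⇒heritage : IntersectionClosed → Heritage F
  ∩-closed⇒heritage ∩-closed X Y FX FY X⊆Y x (x∈Y , FY-x) x∈X =
    x∈X , subst F (p⊆q⇒p∩[q-x]≡p-x X⊆Y) (∩-closed X (Y - x) FX FY-x)

  augment-towards : Augmentable → ∀ {Y Z} → F Z → Y ⊈ Z →
                    ∃[ Z′ ] ∃[ x ] (Z ⊆ Z′ × F Z′ × x ∈ Y × x ∉ Z′ × Y - x ⊆ Z′)
  augment-towards augment {Y} {Z} = go Z (⊃-wellFounded Z)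
    where
    go : ∀ Z → Acc _⊃_ Z → F Z → Y ⊈ Z →
         ∃[ Z′ ] ∃[ x ] (Z ⊆ Z′ × F Z′ × x ∈ Y × x ∉ Z′ × Y - x ⊆ Z′)
    go Z (acc rec) FZ Y⊈Z with augment Z FZ (λ { refl → Y⊈Z ⊆⊤ })
    ... | x , x∉Z , FZ+x with Y ⊆? Z ∪ ⁅ x ⁆
    ...   | no Y⊈Z+x =
      let Z′ , x′ , Z+x⊆Z′ , rest = go (Z ∪ ⁅ x ⁆) (rec (x∉p⇒p⊂p∪⁅x⁆ x∉Z)) FZ+x Y⊈Z+x
      in Z′ , x′ , ⊆-trans (p⊆p∪q ⁅ x ⁆) Z+x⊆Z′ , rest
    ...   | yes Y⊆Z+x with x ∈? Y
    ...     | yes x∈Y = Z , x , ⊆-refl , FZ , x∈Y , x∉Z ,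
                        λ z∈ → let z∈Y , z≢x = x∈p-y⁻ Y z∈ in x∈q∪⁅y⁆∧x≢y⇒x∈q (Y⊆Z+x z∈Y) z≢x
    ...     | no x∉Y  = ⊥-elim (Y⊈Z Y⊆Z)
      where
      Y⊆Z : Y ⊆ Z
      Y⊆Z z∈Y = x∈q∪⁅y⁆∧x≢y⇒x∈q (Y⊆Z+x z∈Y) λ { refl → x∉Y z∈Y }

  ∩-closed∧augmentable⇒chain : IntersectionClosed → Augmentable → ChainProperty F
  ∩-closed∧augmentable⇒chain ∩-closed augment X Y FX FY (_ , w , w∈Y , w∉X)
    with augment-towards augment FX (λ Y⊆X → w∉X (Y⊆X w∈Y))
  ... | Z , x , X⊆Z , FZ , x∈Y , x∉Z , Y-x⊆Z =
    x , x∈Y , (λ x∈X → x∉Z (X⊆Z x∈X)) ,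
    subst F (p-x⊆q∧x∉q⇒p∩q≡p-x Y-x⊆Z x∉Z) (∩-closed Y Z FY FZ)

  -- Descend from W along the chain property until the removed point lies in S
  -- or nothing outside Y is left.
  chain-descent : ChainProperty F → ∀ {Y W S} → F Y → F W → Y ⊂ W → S ⊆ W →
                  ∃[ W′ ] ∃[ y ] (F W′ × S ⊆ W′ × IsExtreme F W′ y × y ∉ Y ×
                                  (y ∈ S ⊎ W′ - y ⊆ Y))
  chain-descent chain {Y} {W} {S} FY = go W (⊂-wellFounded W)
    where
    go : ∀ W → Acc _⊂_ W → F W → Y ⊂ W → S ⊆ W →
         ∃[ W′ ] ∃[ y ] (F W′ × S ⊆ W′ × IsExtreme F W′ y × y ∉ Y × (y ∈ S ⊎ W′ - y ⊆ Y))
    go W (acc rec) FW Y⊂W S⊆W with chain Y W FY FW Y⊂W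
    ... | y , y∈W , y∉Y , FW-y with y ∈? S | W - y ⊆? Y
    ...   | yes y∈S | _         = W , y , FW , S⊆W , (y∈W , FW-y) , y∉Y , inj₁ y∈S
    ...   | no _    | yes W-y⊆Y = W , y , FW , S⊆W , (y∈W , FW-y) , y∉Y , inj₂ W-y⊆Y
    ...   | no y∉S  | no W-y⊈Y  =
      go (W - y) (rec (x∈p⇒p-x⊂p y∈W)) FW-y
         (p⊆q∧q⊈p⇒p⊂q (p⊆q∧x∉p⇒p⊆q-x (proj₁ Y⊂W) y∉Y) W-y⊈Y)
         (p⊆q∧x∉p⇒p⊆q-x S⊆W y∉S)

  chain⇒augmentable : F ⊤ → ChainProperty F → Augmentable
  chain⇒augmentable F⊤ chain X FX X≢⊤
    with chain-descent chain FX F⊤ (p⊆q∧q⊈p⇒p⊂q ⊆⊤ (λ ⊤⊆X → X≢⊤ (⊆-antisym ⊆⊤ ⊤⊆X))) ⊆⊤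
  ... | _ , y , _  , _   , _         , y∉X , inj₁ y∈X   = contradiction y∈X y∉X
  ... | W , y , FW , X⊆W , (y∈W , _) , y∉X , inj₂ W-y⊆X =
    y , y∉X , subst F (p⊆q∧q-x⊆p⇒q≡p∪⁅x⁆ X⊆W y∈W W-y⊆X) FW

  chain∧heritage⇒∩-closed : F ⊤ → ChainProperty F → Heritage F → IntersectionClosed
  chain∧heritage⇒∩-closed F⊤ chain heritage X Y FX FY = go X (⊂-wellFounded X) FX
    where
    go : ∀ X → Acc _⊂_ X → F X → F (X ∩ Y)
    go X (acc rec) FX with X ⊆? Y
    ... | yes X⊆Y = subst F (⊆-antisym (λ z∈X → x∈p∩q⁺ (z∈X , X⊆Y z∈X)) (p∩q⊆p X Y)) FX
    ... | no X⊈Y with p⊈q⇒∃x∈p∖q X⊈Y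
    ...   | x , x∈X , x∉Y with chain-descent chain FY F⊤ (⊆⊤ , x , ∈⊤ , x∉Y) (⊆⊤ {p = X})
    ...     | W , y , FW , X⊆W , y∈exW , y∉Y , stop =
      subst F (x∉q⇒[p-x]∩q≡p∩q y∉Y)
        (go (X - y) (rec (x∈p⇒p-x⊂p y∈X)) (proj₂ (heritage X W FX FW X⊆W y y∈exW y∈X)))
      where
      removed∈X : y ∈ X ⊎ W - y ⊆ Y → y ∈ X
      removed∈X (inj₁ y∈X) = y∈X
      removed∈X (inj₂ W-y⊆Y) with x ≟ y
      ... | yes x≡y = subst (_∈ X) x≡y x∈X
      ... | no x≢y  = contradiction (W-y⊆Y (x∈p∧x≢y⇒x∈p-y (X⊆W x∈X) x≢y)) x∉Y
      y∈X : y ∈ X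
      y∈X = removed∈X stop

mainTheorem2 : (n : ℕ) (F : Family n) → (∀ X → Dec (F X)) →
    IsConvexGeometry F ⇔ ((F ⊥ × F ⊤) × ChainProperty F × Heritage F)
mainTheorem2 n F _ = mk⇔
  (λ cg → let open IsConvexGeometry cg in
    (empty∈ , full∈) , ∩-closed∧augmentable⇒chain F ∩-closed augment , ∩-closed⇒heritage F ∩-closed)
  (λ { ((F⊥ , F⊤) , chain , heritage) → record
    { empty∈   = F⊥
    ; full∈    = F⊤
    ; ∩-closed = chain∧heritage⇒∩-closed F F⊤ chain heritage
    ; augment  = chain⇒augmentable F F⊤ chain
    } })
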